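{- For every $\varepsilon>0$ there exists $n_0$ such that if $G$ is an extremal $3$-edge-colored complete graph on $n\ge n_0$ vertices, then $\mathrm{RBT}(v)\ge 0.4-\varepsilon$ for every vertex $v\in V(G)$.
   Context: A triangle is rainbow if its three edges have distinct colors. A $3$-edge-colored complete graph on $n$ vertices is extremal if it has the maximum number of rainbow triangles among all $3$-edge-colorings of $K_n$. For a vertex $v$ of an $n$-vertex graph, $\mathrm{RBT}(v)$ is the number of rainbow triangles containing $v$ divided by $\binom{n-1}{2}$.
   Formalization: The parameter ε ranges over the positive rationals. -}

module Defs where

open import Data.Nat using (ℕ; _<_; _≤_; _<ᵇ_)
open import Data.Nat.Combinatorics using (_C_)
open import Data.Fin using (Fin; toℕ)
open import Data.Fin.Properties using () renaming (_≟_ to _≟ᶠ_)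
open import Data.Bool using (Bool; true; false; _∧_; not; if_then_else_)
open import Data.List using (List; map)
open import Data.Nat.ListAction using (sum)
open import Data.Rational using (ℚ; _/_)
open import Data.Integer using (+_)
open import Data.List using () renaming (allFin to allFinL)
open import Data.Fin using () 
open import Relation.Nullary.Decidable using (⌊_⌋)
open import Relation.Binary.PropositionalEquality using (_≡_)
import Data.List as L

-- A 3-edge-coloring of K_n: a symmetric map assigning to each pair of
-- vertices one of 3 colors (the value on the diagonal is irrelevant).
record Coloring (n : ℕ) : Set where
  field
    col : Fin n → Fin n → Fin 3
    sym : ∀ i j → col i j ≡ col j i
open Coloring public

allFin : (n : ℕ) → List (Fin n)
allFin n = L.allFin n

ind : Bool → ℕ
ind b = if b then 1 else 0

distinct3 : Fin 3 → Fin 3 → Fin 3 → Bool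
distinct3 a b c = not ⌊ a ≟ᶠ b ⌋ ∧ not ⌊ a ≟ᶠ c ⌋ ∧ not ⌊ b ≟ᶠ c ⌋

rainbow : ∀ {n} → Coloring n → Fin n → Fin n → Fin n → Bool
rainbow c i j k = distinct3 (col c i j) (col c i k) (col c j k)

rainbowCount : ∀ {n} → Coloring n → ℕ
rainbowCount {n} c =
  sum (map (λ i → sum (map (λ j → sum (map (λ k →
    ind ((toℕ i <ᵇ toℕ j) ∧ (toℕ j <ᵇ toℕ k) ∧ rainbow c i j k))
    (allFin n))) (allFin n))) (allFin n))

rainbowAt : ∀ {n} → Coloring n → Fin n → ℕ
rainbowAt {n} c v =
  sum (map (λ j → sum (map (λ k →
    ind (not ⌊ v ≟ᶠ j ⌋ ∧ not ⌊ v ≟ᶠ k ⌋ ∧ (toℕ j <ᵇ toℕ k) ∧ rainbow c v j k))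
    (allFin n))) (allFin n))

Extremal : ∀ {n} → Coloring n → Set
Extremal {n} c = (c' : Coloring n) → rainbowCount c' ≤ rainbowCount c

ℕ→ℚ : ℕ → ℚ
ℕ→ℚ k = (+ k) / 1

module Submission where

-- In an extremal colouring of K_n, replacing a vertex v by a clone of another vertex u keeps every
-- rainbow triangle avoiding v, so extremality gives R(u) ≤ R(v) + 2n for the local counts R, and
-- summing over u gives 3T ≤ n (R(v) + 2n) for the total count T. On the other hand T is at least
-- the count of the iterated blow-up of K₄ coloured by its three perfect matchings (pairs in different
-- residue classes mod 4 take the K₄ colour, pairs in the same class recurse on the quotients), which
-- is n³/15 − O(n²). Hence R(v) ≥ n²/5 − O(n) = (2/5 − o(1)) C(n−1, 2).

open import Defs hiding (sym)
open import Data.Nat using (ℕ; zero; suc; _+_; _*_; _∸_; _≤_; _<_; _≥_; z≤n; s≤s; _<ᵇ_; _≡ᵇ_)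
open import Data.Nat.Properties
open import Data.Nat.Combinatorics using (_C_; nC1≡n; nCk+nC[k+1]≡[n+1]C[k+1])
open import Data.Nat.ListAction using () renaming (sum to listSum)
open import Data.Nat.Tactic.RingSolver using (solve-∀)
open import Data.Fin using (Fin; toℕ) renaming (zero to fz; suc to fs)
open import Data.Fin.Properties using (toℕ-injective) renaming (_≟_ to _≟ᶠ_)
open import Data.Bool using (Bool; true; false; _∧_; _∨_; not; if_then_else_; T)
open import Data.Bool.Properties using (∧-zeroʳ; ∧-identityʳ; ∧-comm; ∧-assoc; T-≡)
open import Data.List using (map)
import Data.List as List
open import Data.Empty using (⊥-elim)
open import Data.Sum using (inj₁; inj₂)
open import Function using (_∘_; Equivalence)
open import Relation.Nullary using (yes; no)
open import Relation.Nullary.Decidable using (⌊_⌋)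
open import Relation.Binary using (tri<; tri≈; tri>)
open import Relation.Binary.PropositionalEquality
open import Data.Product using (∃-syntax; _,_)
open import Data.Nat.Coprimality using (Coprime; 1-coprimeTo) renaming (sym to Coprime-sym)
open import Data.Integer using (+[1+_]; -[1+_])
import Data.Integer as ℤ
import Data.Integer.Properties as ℤ
open import Data.Integer.Tactic.RingSolver using () renaming (solve-∀ to ℤsolve-∀)
import Data.Rational as ℚ
import Data.Rational.Properties as ℚ
import Data.Rational.Unnormalised as ℚᵘ
import Data.Rational.Unnormalised.Properties as ℚᵘ
open import Algebra.Properties.CommutativeSemigroup +-commutativeSemigroup using (x∙yz≈y∙xz)
open import Algebra.Properties.CommutativeMonoid.Sum +-0-commutativeMonoid
  using (sum; sum-syntax; sum-cong-≗; ∑-distrib-+; ∑-comm)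

<ᵇ-true : ∀ {m n} → m < n → (m <ᵇ n) ≡ true
<ᵇ-true m<n = Equivalence.to T-≡ (<⇒<ᵇ m<n)

<ᵇ-false : ∀ {m n} → n ≤ m → (m <ᵇ n) ≡ false
<ᵇ-false {m} {n} n≤m with m <ᵇ n in eq
... | false = refl
... | true  = ⊥-elim (≤⇒≯ n≤m (<ᵇ⇒< m n (Equivalence.from T-≡ eq)))

<ᵇ-irrefl : ∀ m → (m <ᵇ m) ≡ false
<ᵇ-irrefl m = <ᵇ-false {m} ≤-refl

<ᵇ-asym : ∀ m n b → ((m <ᵇ n) ∧ (n <ᵇ m) ∧ b) ≡ false
<ᵇ-asym zero    zero    b = refl
<ᵇ-asym zero    (suc n) b = refl
<ᵇ-asym (suc m) zero    b = refl
<ᵇ-asym (suc m) (suc n) b = <ᵇ-asym m n b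

ind-<ᵇ-sym-split : ∀ a b x → (x ≡ true → a ≢ b) → ind ((a <ᵇ b) ∧ x) + ind ((b <ᵇ a) ∧ x) ≡ ind x
ind-<ᵇ-sym-split a b false _ rewrite ∧-zeroʳ (a <ᵇ b) | ∧-zeroʳ (b <ᵇ a) = refl
ind-<ᵇ-sym-split a b true a≢b rewrite ∧-identityʳ (a <ᵇ b) | ∧-identityʳ (b <ᵇ a) with <-cmp a b
... | tri< a<b _ _ rewrite <ᵇ-true a<b | <ᵇ-false (<⇒≤ a<b) = refl
... | tri≈ _ a≡b _ = ⊥-elim (a≢b refl a≡b)
... | tri> _ _ b<a rewrite <ᵇ-true b<a | <ᵇ-false {a} {b} (<⇒≤ b<a) = refl

ind≤1 : ∀ b → ind b ≤ 1
ind≤1 true  = ≤-refl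
ind≤1 false = z≤n

ind-∧≤ : ∀ a b → ind (a ∧ b) ≤ ind b
ind-∧≤ true  b = ≤-refl
ind-∧≤ false b = z≤n

∑-mono-≤ : ∀ {n} {f g : Fin n → ℕ} → (∀ i → f i ≤ g i) → sum f ≤ sum g
∑-mono-≤ {zero}  f≤g = z≤n
∑-mono-≤ {suc n} f≤g = +-mono-≤ (f≤g fz) (∑-mono-≤ (f≤g ∘ fs))

∑-const : ∀ n c → ∑[ i < n ] c ≡ n * c
∑-const zero    c = refl
∑-const (suc n) c = cong (c +_) (∑-const n c)

∑-if : ∀ {n} b (f : Fin n → ℕ) → ∑[ i < n ] (if b then f i else 0) ≡ (if b then sum f else 0)
∑-if     true  f = refl
∑-if {n} false f = trans (∑-const n 0) (*-zeroʳ n)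

∑-δ : ∀ {n} (v : Fin n) (g : Fin n → ℕ) → ∑[ i < n ] (if ⌊ v ≟ᶠ i ⌋ then g i else 0) ≡ g v
∑-δ {suc n} fz     g = trans (cong (g fz +_) (∑-if false (g ∘ fs))) (+-identityʳ (g fz))
∑-δ {suc n} (fs v) g = trans (sum-cong-≗ shift) (∑-δ v (g ∘ fs))
  where
  shift : ∀ i → (if ⌊ fs v ≟ᶠ fs i ⌋ then g (fs i) else 0) ≡ (if ⌊ v ≟ᶠ i ⌋ then g (fs i) else 0)
  shift i with v ≟ᶠ i
  ... | yes refl = refl
  ... | no  _    = refl

∑² : ∀ {n} → (Fin n → Fin n → ℕ) → ℕ
∑² {n} f = ∑[ j < n ] ∑[ k < n ] f j k

∑³ : ∀ {n} → (Fin n → Fin n → Fin n → ℕ) → ℕ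
∑³ {n} f = ∑[ i < n ] ∑[ j < n ] ∑[ k < n ] f i j k

∑²-distrib-+ : ∀ {n} (f g : Fin n → Fin n → ℕ) → ∑² (λ j k → f j k + g j k) ≡ ∑² f + ∑² g
∑²-distrib-+ f g = trans (sum-cong-≗ (λ j → ∑-distrib-+ (f j) (g j))) (∑-distrib-+ (λ j → sum (f j)) (λ j → sum (g j)))

∑³-distrib-+ : ∀ {n} (f g : Fin n → Fin n → Fin n → ℕ) → ∑³ (λ i j k → f i j k + g i j k) ≡ ∑³ f + ∑³ g
∑³-distrib-+ f g = trans (sum-cong-≗ (λ i → ∑²-distrib-+ (f i) (g i))) (∑-distrib-+ (λ i → ∑² (f i)) (λ i → ∑² (g i)))

∑³-pin₁ : ∀ {n} v (f : Fin n → Fin n → Fin n → ℕ) → ∑³ (λ i j k → if ⌊ v ≟ᶠ i ⌋ then f i j k else 0) ≡ ∑² (f v)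
∑³-pin₁ v f = trans (sum-cong-≗ λ i → trans (sum-cong-≗ λ j → ∑-if ⌊ v ≟ᶠ i ⌋ (f i j)) (∑-if ⌊ v ≟ᶠ i ⌋ (λ j → sum (f i j))))
                    (∑-δ v (λ i → ∑² (f i)))

∑³-pin₂ : ∀ {n} v (f : Fin n → Fin n → Fin n → ℕ) → ∑³ (λ i j k → if ⌊ v ≟ᶠ j ⌋ then f i j k else 0) ≡ ∑² (λ i k → f i v k)
∑³-pin₂ v f = sum-cong-≗ λ i → trans (sum-cong-≗ λ j → ∑-if ⌊ v ≟ᶠ j ⌋ (f i j)) (∑-δ v (λ j → sum (f i j)))

∑³-pin₃ : ∀ {n} v (f : Fin n → Fin n → Fin n → ℕ) → ∑³ (λ i j k → if ⌊ v ≟ᶠ k ⌋ then f i j k else 0) ≡ ∑² (λ i j → f i j v)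
∑³-pin₃ v f = sum-cong-≗ λ i → sum-cong-≗ λ j → ∑-δ v (f i j)

listSum-allFin : ∀ {n} (f : Fin n → ℕ) → listSum (map f (allFin n)) ≡ sum f
listSum-allFin f = go f (λ i → i)
  where
  go : ∀ {n m} (f : Fin m → ℕ) (h : Fin n → Fin m) → listSum (map f (List.tabulate h)) ≡ sum (f ∘ h)
  go {zero}  f h = refl
  go {suc n} f h = cong (f (h fz) +_) (go f (h ∘ fs))

-- Counting rainbow triangles

≟ᶠ-sym : ∀ {n} (a b : Fin n) → ⌊ a ≟ᶠ b ⌋ ≡ ⌊ b ≟ᶠ a ⌋
≟ᶠ-sym a b with a ≟ᶠ b | b ≟ᶠ a
... | yes _    | yes _   = refl
... | no  _    | no  _   = refl
... | yes refl | no  b≢a = ⊥-elim (b≢a refl)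
... | no  a≢b  | yes refl = ⊥-elim (a≢b refl)

∧-swapˡ : ∀ x y z → (x ∧ y ∧ z) ≡ (y ∧ x ∧ z)
∧-swapˡ x y z = trans (sym (∧-assoc x y z)) (trans (cong (_∧ z) (∧-comm x y)) (∧-assoc y x z))

distinct3-swap₁₂ : ∀ a b c → distinct3 a b c ≡ distinct3 b a c
distinct3-swap₁₂ a b c = cong₂ _∧_ (cong not (≟ᶠ-sym a b)) (∧-comm (not ⌊ a ≟ᶠ c ⌋) (not ⌊ b ≟ᶠ c ⌋))

distinct3-swap₂₃ : ∀ a b c → distinct3 a b c ≡ distinct3 a c b
distinct3-swap₂₃ a b c =
  trans (∧-swapˡ (not ⌊ a ≟ᶠ b ⌋) (not ⌊ a ≟ᶠ c ⌋) (not ⌊ b ≟ᶠ c ⌋)) (cong (λ x → not ⌊ a ≟ᶠ c ⌋ ∧ not ⌊ a ≟ᶠ b ⌋ ∧ not x) (≟ᶠ-sym b c))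

-- A third point a ≠ b, c lies below, between or above the pair b < c.
ind-<ᵇ-split : ∀ a b c x → a ≢ b → a ≢ c →
  ind ((b <ᵇ c) ∧ x) ≡ ind ((a <ᵇ b) ∧ (b <ᵇ c) ∧ x) + ind ((b <ᵇ a) ∧ (a <ᵇ c) ∧ x) + ind ((b <ᵇ c) ∧ (c <ᵇ a) ∧ x)
ind-<ᵇ-split a b c false _ _
  rewrite ∧-zeroʳ (b <ᵇ c) | ∧-zeroʳ (a <ᵇ c) | ∧-zeroʳ (c <ᵇ a) | ∧-zeroʳ (a <ᵇ b) | ∧-zeroʳ (b <ᵇ a)
  | ∧-zeroʳ (b <ᵇ c) = refl
ind-<ᵇ-split a b c true a≢b a≢c
  rewrite ∧-identityʳ (b <ᵇ c) | ∧-identityʳ (a <ᵇ c) | ∧-identityʳ (c <ᵇ a) with <-cmp a b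
... | tri≈ _ a≡b _ = ⊥-elim (a≢b a≡b)
... | tri< a<b _ _ rewrite <ᵇ-true a<b | <ᵇ-false (<⇒≤ a<b) with <-cmp b c
...   | tri< b<c _ _ rewrite <ᵇ-true b<c | <ᵇ-false {c} {a} (<⇒≤ (<-trans a<b b<c)) = refl
...   | tri≈ _ refl _ rewrite <ᵇ-irrefl b = refl
...   | tri> _ _ c<b rewrite <ᵇ-false {b} {c} (<⇒≤ c<b) = refl
ind-<ᵇ-split a b c true a≢b a≢c | tri> _ _ b<a rewrite <ᵇ-true b<a | <ᵇ-false (<⇒≤ b<a) with <-cmp a c
... | tri≈ _ a≡c _ = ⊥-elim (a≢c a≡c)
... | tri< a<c _ _ rewrite <ᵇ-true a<c | <ᵇ-true (<-trans b<a a<c) | <ᵇ-false {c} {a} (<⇒≤ a<c) = refl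
... | tri> _ _ c<a rewrite <ᵇ-false {a} {c} (<⇒≤ c<a) | <ᵇ-true c<a | ∧-identityʳ (b <ᵇ c) = refl

module _ {n : ℕ} (c : Coloring n) where

  orderedRainbow : Fin n → Fin n → Fin n → ℕ
  orderedRainbow i j k = ind ((toℕ i <ᵇ toℕ j) ∧ (toℕ j <ᵇ toℕ k) ∧ rainbow c i j k)

  rainbowAsMin rainbowAsMid rainbowAsMax : Fin n → ℕ
  rainbowAsMin v = ∑² (λ j k → orderedRainbow v j k)
  rainbowAsMid v = ∑² (λ j k → orderedRainbow j v k)
  rainbowAsMax v = ∑² (λ j k → orderedRainbow j k v)

  rainbowCount≡∑³ : rainbowCount c ≡ ∑³ orderedRainbow
  rainbowCount≡∑³ =
    trans (listSum-allFin (λ i → listSum (map (λ j → listSum (map (orderedRainbow i j) (allFin n))) (allFin n))))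
      (sum-cong-≗ λ i → trans (listSum-allFin (λ j → listSum (map (orderedRainbow i j) (allFin n))))
        (sum-cong-≗ λ j → listSum-allFin (orderedRainbow i j)))

  orderedRainbow-vvk : ∀ v k → orderedRainbow v v k ≡ 0
  orderedRainbow-vvk v k = cong (λ b → ind (b ∧ (toℕ v <ᵇ toℕ k) ∧ rainbow c v v k)) (<ᵇ-irrefl (toℕ v))

  orderedRainbow-vkv : ∀ v k → orderedRainbow v k v ≡ 0
  orderedRainbow-vkv v k = cong ind (<ᵇ-asym (toℕ v) (toℕ k) (rainbow c v k v))

  orderedRainbow-kvv : ∀ v k → orderedRainbow k v v ≡ 0
  orderedRainbow-kvv v k = cong ind (trans (cong (λ b → (toℕ k <ᵇ toℕ v) ∧ b ∧ rainbow c k v v) (<ᵇ-irrefl (toℕ v)))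
                                           (∧-zeroʳ (toℕ k <ᵇ toℕ v)))

  rainbow-swap₁₂ : ∀ v j k → rainbow c j v k ≡ rainbow c v j k
  rainbow-swap₁₂ v j k rewrite Coloring.sym c j v = distinct3-swap₂₃ (col c v j) (col c j k) (col c v k)

  rainbow-rotate : ∀ v j k → rainbow c j k v ≡ rainbow c v j k
  rainbow-rotate v j k rewrite Coloring.sym c j v | Coloring.sym c k v =
    trans (distinct3-swap₁₂ (col c j k) (col c v j) (col c v k)) (distinct3-swap₂₃ (col c v j) (col c j k) (col c v k))

  rainbowAtSummand : Fin n → Fin n → Fin n → ℕ
  rainbowAtSummand v j k = ind (not ⌊ v ≟ᶠ j ⌋ ∧ not ⌊ v ≟ᶠ k ⌋ ∧ (toℕ j <ᵇ toℕ k) ∧ rainbow c v j k)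

  rainbowAt≡∑² : ∀ v → rainbowAt c v ≡ ∑² (rainbowAtSummand v)
  rainbowAt≡∑² v = trans (listSum-allFin (λ j → listSum (map (rainbowAtSummand v j) (allFin n))))
                         (sum-cong-≗ λ j → listSum-allFin (rainbowAtSummand v j))

  rainbowAt-term : ∀ v j k → rainbowAtSummand v j k ≡ orderedRainbow v j k + orderedRainbow j v k + orderedRainbow j k v
  rainbowAt-term v j k with v ≟ᶠ j | v ≟ᶠ k
  ... | yes refl | _ rewrite orderedRainbow-vvk v k | orderedRainbow-vkv v k = refl
  ... | no _ | yes refl rewrite orderedRainbow-vkv v j | orderedRainbow-kvv v j = refl
  ... | no v≢j | no v≢k =
    trans (ind-<ᵇ-split (toℕ v) (toℕ j) (toℕ k) (rainbow c v j k) (v≢j ∘ toℕ-injective) (v≢k ∘ toℕ-injective))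
      (cong₂ _+_ (cong (orderedRainbow v j k +_) (cong (λ b → ind ((toℕ j <ᵇ toℕ v) ∧ (toℕ v <ᵇ toℕ k) ∧ b)) (sym (rainbow-swap₁₂ v j k))))
                 (cong (λ b → ind ((toℕ j <ᵇ toℕ k) ∧ (toℕ k <ᵇ toℕ v) ∧ b)) (sym (rainbow-rotate v j k))))

  rainbowAt≡min+mid+max : ∀ v → rainbowAt c v ≡ rainbowAsMin v + rainbowAsMid v + rainbowAsMax v
  rainbowAt≡min+mid+max v = begin
      rainbowAt c v
    ≡⟨ trans (rainbowAt≡∑² v) (sum-cong-≗ λ j → sum-cong-≗ (rainbowAt-term v j)) ⟩
      ∑² (λ j k → orderedRainbow v j k + orderedRainbow j v k + orderedRainbow j k v)
    ≡⟨ ∑²-distrib-+ (λ j k → orderedRainbow v j k + orderedRainbow j v k) (λ j k → orderedRainbow j k v) ⟩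
      ∑² (λ j k → orderedRainbow v j k + orderedRainbow j v k) + rainbowAsMax v
    ≡⟨ cong (_+ rainbowAsMax v) (∑²-distrib-+ (orderedRainbow v) (λ j k → orderedRainbow j v k)) ⟩
      rainbowAsMin v + rainbowAsMid v + rainbowAsMax v ∎
    where open ≡-Reasoning

  rainbowAvoiding : Fin n → ℕ
  rainbowAvoiding v = ∑³ λ i j k → if not ⌊ v ≟ᶠ i ⌋ ∧ not ⌊ v ≟ᶠ j ⌋ ∧ not ⌊ v ≟ᶠ k ⌋ then orderedRainbow i j k else 0

  ∑-handshake : ∑[ v < n ] rainbowAt c v ≡ 3 * ∑³ orderedRainbow
  ∑-handshake = begin
      ∑[ v < n ] rainbowAt c v
    ≡⟨ sum-cong-≗ rainbowAt≡min+mid+max ⟩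
      ∑[ v < n ] (rainbowAsMin v + rainbowAsMid v + rainbowAsMax v)
    ≡⟨ trans (∑-distrib-+ (λ v → rainbowAsMin v + rainbowAsMid v) rainbowAsMax)
             (cong (_+ sum rainbowAsMax) (∑-distrib-+ rainbowAsMin rainbowAsMid)) ⟩
      sum rainbowAsMin + sum rainbowAsMid + sum rainbowAsMax
    ≡⟨ cong₂ _+_ (cong (∑³ orderedRainbow +_) mid) max ⟩
      ∑³ orderedRainbow + ∑³ orderedRainbow + ∑³ orderedRainbow
    ≡⟨ thrice (∑³ orderedRainbow) ⟩
      3 * ∑³ orderedRainbow ∎
    where
    open ≡-Reasoning
    thrice : ∀ t → t + t + t ≡ 3 * t
    thrice = solve-∀
    mid : sum rainbowAsMid ≡ ∑³ orderedRainbow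
    mid = ∑-comm (λ v j → ∑[ k < n ] orderedRainbow j v k)
    max : sum rainbowAsMax ≡ ∑³ orderedRainbow
    max = trans (∑-comm (λ v j → ∑[ k < n ] orderedRainbow j k v)) (sum-cong-≗ λ j → ∑-comm (λ v k → orderedRainbow j k v))

  orderedRainbow-split : ∀ v i j k → orderedRainbow i j k ≡
       (if not ⌊ v ≟ᶠ i ⌋ ∧ not ⌊ v ≟ᶠ j ⌋ ∧ not ⌊ v ≟ᶠ k ⌋ then orderedRainbow i j k else 0)
       + (if ⌊ v ≟ᶠ i ⌋ then orderedRainbow i j k else 0)
       + (if ⌊ v ≟ᶠ j ⌋ then orderedRainbow i j k else 0)
       + (if ⌊ v ≟ᶠ k ⌋ then orderedRainbow i j k else 0)
  orderedRainbow-split v i j k with v ≟ᶠ i | v ≟ᶠ j | v ≟ᶠ k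
  ... | yes refl | yes refl | yes refl rewrite orderedRainbow-vvk v v = refl
  ... | yes refl | yes refl | no _     rewrite orderedRainbow-vvk v k = refl
  ... | yes refl | no _     | yes refl rewrite orderedRainbow-vkv v j = refl
  ... | yes refl | no _     | no _     = sym (trans (+-identityʳ _) (+-identityʳ _))
  ... | no _     | yes refl | yes refl rewrite orderedRainbow-kvv v i = refl
  ... | no _     | yes refl | no _     = sym (+-identityʳ _)
  ... | no _     | no _     | yes refl = refl
  ... | no _     | no _     | no _     = sym (trans (+-identityʳ _) (trans (+-identityʳ _) (+-identityʳ _)))

  rainbowCount≡avoiding+rainbowAt : ∀ v → rainbowCount c ≡ rainbowAvoiding v + rainbowAt c v
  rainbowCount≡avoiding+rainbowAt v = begin
      rainbowCount c
    ≡⟨ rainbowCount≡∑³ ⟩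
      ∑³ orderedRainbow
    ≡⟨ sum-cong-≗ (λ i → sum-cong-≗ λ j → sum-cong-≗ λ k → orderedRainbow-split v i j k) ⟩
      ∑³ (λ i j k → N i j k + A i j k + B i j k + C i j k)
    ≡⟨ ∑³-distrib-+ (λ i j k → N i j k + A i j k + B i j k) C ⟩
      ∑³ (λ i j k → N i j k + A i j k + B i j k) + ∑³ C
    ≡⟨ cong (_+ ∑³ C) (∑³-distrib-+ (λ i j k → N i j k + A i j k) B) ⟩
      ∑³ (λ i j k → N i j k + A i j k) + ∑³ B + ∑³ C
    ≡⟨ cong (λ x → x + ∑³ B + ∑³ C) (∑³-distrib-+ N A) ⟩
      rainbowAvoiding v + ∑³ A + ∑³ B + ∑³ C
    ≡⟨ cong₂ _+_ (cong₂ _+_ (cong (rainbowAvoiding v +_) (∑³-pin₁ v orderedRainbow)) (∑³-pin₂ v orderedRainbow))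
                 (∑³-pin₃ v orderedRainbow) ⟩
      rainbowAvoiding v + rainbowAsMin v + rainbowAsMid v + rainbowAsMax v
    ≡⟨ +-assoc₄ (rainbowAvoiding v) (rainbowAsMin v) (rainbowAsMid v) (rainbowAsMax v) ⟩
      rainbowAvoiding v + (rainbowAsMin v + rainbowAsMid v + rainbowAsMax v)
    ≡⟨ cong (rainbowAvoiding v +_) (sym (rainbowAt≡min+mid+max v)) ⟩
      rainbowAvoiding v + rainbowAt c v ∎
    where
    open ≡-Reasoning
    +-assoc₄ : ∀ a b c d → a + b + c + d ≡ a + (b + c + d)
    +-assoc₄ = solve-∀
    N A B C : Fin n → Fin n → Fin n → ℕ
    N i j k = if not ⌊ v ≟ᶠ i ⌋ ∧ not ⌊ v ≟ᶠ j ⌋ ∧ not ⌊ v ≟ᶠ k ⌋ then orderedRainbow i j k else 0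
    A i j k = if ⌊ v ≟ᶠ i ⌋ then orderedRainbow i j k else 0
    B i j k = if ⌊ v ≟ᶠ j ⌋ then orderedRainbow i j k else 0
    C i j k = if ⌊ v ≟ᶠ k ⌋ then orderedRainbow i j k else 0

-- Cloning a vertex

module Clone {n : ℕ} (c : Coloring n) (u v : Fin n) where

  relabel : Fin n → Fin n
  relabel x = if ⌊ v ≟ᶠ x ⌋ then u else x

  -- v becomes a copy of u; the edge uv gets the colour of the loop at u, which is irrelevant
  cloned : Coloring n
  cloned = record { col = λ x y → col c (relabel x) (relabel y) ; sym = λ x y → Coloring.sym c (relabel x) (relabel y) }

  relabel-v : relabel v ≡ u
  relabel-v with v ≟ᶠ v
  ... | yes _   = refl
  ... | no  v≢v = ⊥-elim (v≢v refl)

  avoiding-term : ∀ i j k →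
    (if not ⌊ v ≟ᶠ i ⌋ ∧ not ⌊ v ≟ᶠ j ⌋ ∧ not ⌊ v ≟ᶠ k ⌋ then orderedRainbow cloned i j k else 0)
    ≡ (if not ⌊ v ≟ᶠ i ⌋ ∧ not ⌊ v ≟ᶠ j ⌋ ∧ not ⌊ v ≟ᶠ k ⌋ then orderedRainbow c i j k else 0)
  avoiding-term i j k with v ≟ᶠ i | v ≟ᶠ j | v ≟ᶠ k
  ... | yes _ | _     | _     = refl
  ... | no  _ | yes _ | _     = refl
  ... | no  _ | no  _ | yes _ = refl
  ... | no  _ | no  _ | no  _ = refl

  rainbowAvoiding-cloned : rainbowAvoiding cloned v ≡ rainbowAvoiding c v
  rainbowAvoiding-cloned = sum-cong-≗ λ i → sum-cong-≗ λ j → sum-cong-≗ λ k → avoiding-term i j k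

  δ : Fin n → ℕ
  δ x = if ⌊ v ≟ᶠ x ⌋ then 1 else 0

  rainbowAt-term-cloned : ∀ j k → rainbowAtSummand c u j k ≤ rainbowAtSummand cloned v j k + δ j + δ k
  rainbowAt-term-cloned j k with v ≟ᶠ j | v ≟ᶠ k
  ... | yes _ | _     = ≤-trans (ind≤1 _) (s≤s z≤n)
  ... | no  _ | yes _ = ind≤1 _
  ... | no  _ | no  _ = begin
      rainbowAtSummand c u j k
    ≤⟨ ≤-trans (ind-∧≤ (not ⌊ u ≟ᶠ j ⌋) _) (ind-∧≤ (not ⌊ u ≟ᶠ k ⌋) _) ⟩
      ind ((toℕ j <ᵇ toℕ k) ∧ distinct3 (col c u j) (col c u k) (col c j k))
    ≡⟨ cong (λ w → ind ((toℕ j <ᵇ toℕ k) ∧ distinct3 (col c w j) (col c w k) (col c j k))) (sym relabel-v) ⟩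
      ind ((toℕ j <ᵇ toℕ k) ∧ distinct3 (col c (relabel v) j) (col c (relabel v) k) (col c j k))
    ≡⟨ sym (trans (+-identityʳ _) (+-identityʳ _)) ⟩
      ind ((toℕ j <ᵇ toℕ k) ∧ distinct3 (col c (relabel v) j) (col c (relabel v) k) (col c j k)) + 0 + 0 ∎
    where open ≤-Reasoning

  ∑²-δ-left : ∑² (λ j k → δ j) ≡ n
  ∑²-δ-left = trans (sum-cong-≗ λ j → ∑-const n (δ j)) (trans (sum-cong-≗ n*δ) (∑-δ v (λ _ → n)))
    where
    n*δ : ∀ j → n * δ j ≡ (if ⌊ v ≟ᶠ j ⌋ then n else 0)
    n*δ j with ⌊ v ≟ᶠ j ⌋
    ... | true  = *-identityʳ n
    ... | false = *-zeroʳ n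

  ∑²-δ-right : ∑² (λ j k → δ k) ≡ n
  ∑²-δ-right = trans (sum-cong-≗ {n} λ j → ∑-δ v (λ _ → 1)) (trans (∑-const n 1) (*-identityʳ n))

  rainbowAt-cloned : rainbowAt c u ≤ rainbowAt cloned v + (n + n)
  rainbowAt-cloned = begin
      rainbowAt c u
    ≡⟨ rainbowAt≡∑² c u ⟩
      ∑² (rainbowAtSummand c u)
    ≤⟨ ∑-mono-≤ (λ j → ∑-mono-≤ (rainbowAt-term-cloned j)) ⟩
      ∑² (λ j k → rainbowAtSummand cloned v j k + δ j + δ k)
    ≡⟨ ∑²-distrib-+ (λ j k → rainbowAtSummand cloned v j k + δ j) (λ j k → δ k) ⟩
      ∑² (λ j k → rainbowAtSummand cloned v j k + δ j) + ∑² (λ j k → δ k)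
    ≡⟨ cong₂ _+_ (∑²-distrib-+ (rainbowAtSummand cloned v) (λ j k → δ j)) ∑²-δ-right ⟩
      ∑² (rainbowAtSummand cloned v) + ∑² (λ j k → δ j) + n
    ≡⟨ cong₂ (λ x y → x + y + n) (sym (rainbowAt≡∑² cloned v)) ∑²-δ-left ⟩
      rainbowAt cloned v + n + n
    ≡⟨ +-assoc (rainbowAt cloned v) n n ⟩
      rainbowAt cloned v + (n + n) ∎
    where open ≤-Reasoning

-- Replacing v by a clone of u keeps every triangle avoiding v and turns the triangles at u into
-- triangles at v (up to the 2n ones containing both); extremality then bounds the latter.
rainbowAt-extremal : ∀ {n} (c : Coloring n) → Extremal c → ∀ u v → rainbowAt c u ≤ rainbowAt c v + (n + n)
rainbowAt-extremal {n} c extremal u v = ≤-trans rainbowAt-cloned (+-monoˡ-≤ (n + n) cloned≤c)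
  where
  open Clone c u v
  cloned≤c : rainbowAt cloned v ≤ rainbowAt c v
  cloned≤c = +-cancelˡ-≤ (rainbowAvoiding c v) _ _
    (subst₂ _≤_ (trans (rainbowCount≡avoiding+rainbowAt cloned v) (cong (_+ rainbowAt cloned v) rainbowAvoiding-cloned))
                (rainbowCount≡avoiding+rainbowAt c v)
                (extremal cloned))

rainbowCount-extremal : ∀ {n} (c : Coloring n) → Extremal c → ∀ v → 3 * rainbowCount c ≤ n * (rainbowAt c v + (n + n))
rainbowCount-extremal {n} c extremal v = begin
    3 * rainbowCount c
  ≡⟨ cong (3 *_) (rainbowCount≡∑³ c) ⟩
    3 * ∑³ (orderedRainbow c)
  ≡⟨ ∑-handshake c ⟨
    ∑[ u < n ] rainbowAt c u
  ≤⟨ ∑-mono-≤ (λ u → rainbowAt-extremal c extremal u v) ⟩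
    ∑[ u < n ] (rainbowAt c v + (n + n))
  ≡⟨ ∑-const n (rainbowAt c v + (n + n)) ⟩
    n * (rainbowAt c v + (n + n)) ∎
  where open ≤-Reasoning

sumBelow : ℕ → (ℕ → ℕ) → ℕ
sumBelow zero    g = 0
sumBelow (suc n) g = sumBelow n g + g n

sumBelow-mono : ∀ n {f g : ℕ → ℕ} → (∀ i → i < n → f i ≤ g i) → sumBelow n f ≤ sumBelow n g
sumBelow-mono zero    f≤g = z≤n
sumBelow-mono (suc n) f≤g = +-mono-≤ (sumBelow-mono n (λ i i<n → f≤g i (m<n⇒m<1+n i<n))) (f≤g n (n<1+n n))

sumBelow-cong : ∀ n {f g : ℕ → ℕ} → (∀ i → i < n → f i ≡ g i) → sumBelow n f ≡ sumBelow n g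
sumBelow-cong zero    f≡g = refl
sumBelow-cong (suc n) f≡g = cong₂ _+_ (sumBelow-cong n (λ i i<n → f≡g i (m<n⇒m<1+n i<n))) (f≡g n (n<1+n n))

sumBelow-distrib-+ : ∀ n (f g : ℕ → ℕ) → sumBelow n (λ i → f i + g i) ≡ sumBelow n f + sumBelow n g
sumBelow-distrib-+ zero    f g = refl
sumBelow-distrib-+ (suc n) f g rewrite sumBelow-distrib-+ n f g = +-interchange (sumBelow n f) (sumBelow n g) (f n) (g n)
  where
  +-interchange : ∀ a b c d → a + b + (c + d) ≡ a + c + (b + d)
  +-interchange = solve-∀

sumBelow-*ˡ : ∀ c n f → c * sumBelow n f ≡ sumBelow n (λ i → c * f i)
sumBelow-*ˡ c zero    f = *-zeroʳ c
sumBelow-*ˡ c (suc n) f = trans (*-distribˡ-+ c (sumBelow n f) (f n)) (cong (_+ c * f n) (sumBelow-*ˡ c n f))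

sumBelow-zero : ∀ n → sumBelow n (λ _ → 0) ≡ 0
sumBelow-zero zero    = refl
sumBelow-zero (suc n) = trans (+-identityʳ _) (sumBelow-zero n)

sumBelow-comm : ∀ n m (f : ℕ → ℕ → ℕ) → sumBelow n (λ i → sumBelow m (f i)) ≡ sumBelow m (λ j → sumBelow n (λ i → f i j))
sumBelow-comm zero    m f = sym (sumBelow-zero m)
sumBelow-comm (suc n) m f =
  trans (cong (_+ sumBelow m (f n)) (sumBelow-comm n m f)) (sym (sumBelow-distrib-+ m (λ j → sumBelow n (λ i → f i j)) (f n)))

sumBelow-ordered-pairs : ∀ n (P : ℕ → ℕ → Bool) → (∀ a b → P b a ≡ P a b) → (∀ a b → P a b ≡ true → a ≢ b) →
  sumBelow n (λ a → sumBelow n (λ b → ind (P a b))) ≡ 2 * sumBelow n (λ a → sumBelow n (λ b → ind ((a <ᵇ b) ∧ P a b)))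
sumBelow-ordered-pairs n P P-sym P-≢ = begin
    sumBelow n (λ a → sumBelow n (λ b → ind (P a b)))
  ≡⟨ sumBelow-cong n (λ a _ → sumBelow-cong n (λ b _ → split a b)) ⟨
    sumBelow n (λ a → sumBelow n (λ b → pair a b + pair b a))
  ≡⟨ sumBelow-cong n (λ a _ → sumBelow-distrib-+ n (pair a) (λ b → pair b a)) ⟩
    sumBelow n (λ a → sumBelow n (pair a) + sumBelow n (λ b → pair b a))
  ≡⟨ sumBelow-distrib-+ n (λ a → sumBelow n (pair a)) (λ a → sumBelow n (λ b → pair b a)) ⟩
    S + sumBelow n (λ a → sumBelow n (λ b → pair b a))
  ≡⟨ cong (S +_) (sumBelow-comm n n pair) ⟨
    S + S
  ≡⟨ cong (S +_) (+-identityʳ S) ⟨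
    2 * S ∎
  where
  open ≡-Reasoning
  pair : ℕ → ℕ → ℕ
  pair a b = ind ((a <ᵇ b) ∧ P a b)
  S = sumBelow n (λ a → sumBelow n (pair a))
  split : ∀ a b → pair a b + pair b a ≡ ind (P a b)
  split a b = trans (cong (λ x → pair a b + ind ((b <ᵇ a) ∧ x)) (P-sym a b)) (ind-<ᵇ-sym-split a b (P a b) (P-≢ a b))

sumBelow-monoˡ : ∀ {m n} (f : ℕ → ℕ) → m ≤ n → sumBelow m f ≤ sumBelow n f
sumBelow-monoˡ {n = zero}  f z≤n = z≤n
sumBelow-monoˡ {n = suc n} f m≤1+n with m≤n⇒m<n∨m≡n m≤1+n
... | inj₁ (s≤s m≤n) = ≤-trans (sumBelow-monoˡ f m≤n) (m≤m+n _ _)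
... | inj₂ refl      = ≤-refl

sumBelow-if : ∀ n b (f : ℕ → ℕ) → sumBelow n (λ i → if b then f i else 0) ≡ (if b then sumBelow n f else 0)
sumBelow-if n true  f = refl
sumBelow-if n false f = sumBelow-zero n

sumBelow-suc : ∀ n g → sumBelow (suc n) g ≡ g 0 + sumBelow n (g ∘ suc)
sumBelow-suc zero    g = sym (+-identityʳ (g 0))
sumBelow-suc (suc n) g rewrite sumBelow-suc n g = +-assoc (g 0) _ _

∑-toℕ : ∀ n (g : ℕ → ℕ) → ∑[ i < n ] g (toℕ i) ≡ sumBelow n g
∑-toℕ zero    g = refl
∑-toℕ (suc n) g = trans (cong (g 0 +_) (∑-toℕ n (g ∘ suc))) (sym (sumBelow-suc n g))

rem4 : ℕ → ℕ
rem4 0 = 0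
rem4 1 = 1
rem4 2 = 2
rem4 3 = 3
rem4 (suc (suc (suc (suc x)))) = rem4 x

quot4 : ℕ → ℕ
quot4 0 = 0
quot4 1 = 0
quot4 2 = 0
quot4 3 = 0
quot4 (suc (suc (suc (suc x)))) = suc (quot4 x)

base4 : ℕ → ℕ → ℕ
base4 zero    r = r
base4 (suc q) r = 4 + base4 q r

rem4<4 : ∀ x → rem4 x < 4
rem4<4 0 = s≤s z≤n
rem4<4 1 = s≤s (s≤s z≤n)
rem4<4 2 = s≤s (s≤s (s≤s z≤n))
rem4<4 3 = ≤-refl
rem4<4 (suc (suc (suc (suc x)))) = rem4<4 x

rem4-small : ∀ r → r < 4 → rem4 r ≡ r
rem4-small 0 _ = refl
rem4-small 1 _ = refl
rem4-small 2 _ = refl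
rem4-small 3 _ = refl
rem4-small (suc (suc (suc (suc r)))) (s≤s (s≤s (s≤s (s≤s ()))))

base4-quot4-rem4 : ∀ x → base4 (quot4 x) (rem4 x) ≡ x
base4-quot4-rem4 0 = refl
base4-quot4-rem4 1 = refl
base4-quot4-rem4 2 = refl
base4-quot4-rem4 3 = refl
base4-quot4-rem4 (suc (suc (suc (suc x)))) = cong (4 +_) (base4-quot4-rem4 x)

base4≡ : ∀ q r → base4 q r ≡ q * 4 + r
base4≡ zero    r = refl
base4≡ (suc q) r = cong (4 +_) (base4≡ q r)

rem4-base4 : ∀ k q r → rem4 (k + base4 q r) ≡ rem4 (k + r)
rem4-base4 k zero    r = refl
rem4-base4 k (suc q) r = trans (cong rem4 (x∙yz≈y∙xz k 4 (base4 q r))) (rem4-base4 k q r)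

quot4-base4 : ∀ q r → r < 4 → quot4 (base4 q r) ≡ q
quot4-base4 zero 0 _ = refl
quot4-base4 zero 1 _ = refl
quot4-base4 zero 2 _ = refl
quot4-base4 zero 3 _ = refl
quot4-base4 zero (suc (suc (suc (suc r)))) (s≤s (s≤s (s≤s (s≤s ()))))
quot4-base4 (suc q) r r<4 = cong suc (quot4-base4 q r r<4)

quot4-mono : ∀ {x y} → x ≤ y → quot4 x ≤ quot4 y
quot4-mono {0} _ = z≤n
quot4-mono {1} _ = z≤n
quot4-mono {2} _ = z≤n
quot4-mono {3} _ = z≤n
quot4-mono {suc (suc (suc (suc x)))} (s≤s (s≤s (s≤s (s≤s x≤y)))) = s≤s (quot4-mono x≤y)

quot4≤ : ∀ x → quot4 x ≤ x
quot4≤ 0 = z≤n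
quot4≤ 1 = z≤n
quot4≤ 2 = z≤n
quot4≤ 3 = z≤n
quot4≤ (suc (suc (suc (suc x)))) = s≤s (≤-trans (quot4≤ x) (m≤n+m x 3))

quot4-suc≤ : ∀ x → quot4 (suc x) ≤ x
quot4-suc≤ 0 = z≤n
quot4-suc≤ 1 = z≤n
quot4-suc≤ 2 = z≤n
quot4-suc≤ (suc (suc (suc x))) = s≤s (≤-trans (quot4≤ x) (m≤n+m x 2))

quot4-≤-pred : ∀ {D} n → n ≤ suc D → quot4 n ≤ D
quot4-≤-pred zero    _       = z≤n
quot4-≤-pred (suc m) m<1+D = ≤-trans (quot4-suc≤ m) (≤-pred m<1+D)

≡ᵇ-true⇒≡ : ∀ a b → (a ≡ᵇ b) ≡ true → a ≡ b
≡ᵇ-true⇒≡ a b e = ≡ᵇ⇒≡ a b (Equivalence.from T-≡ e)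

≡⇒≡ᵇ-true : ∀ a b → a ≡ b → (a ≡ᵇ b) ≡ true
≡⇒≡ᵇ-true a b e = Equivalence.to T-≡ (≡⇒≡ᵇ a b e)

≡ᵇ-refl : ∀ a → (a ≡ᵇ a) ≡ true
≡ᵇ-refl a = ≡⇒≡ᵇ-true a a refl

≡ᵇ-sym : ∀ a b → (a ≡ᵇ b) ≡ (b ≡ᵇ a)
≡ᵇ-sym zero    zero    = refl
≡ᵇ-sym zero    (suc b) = refl
≡ᵇ-sym (suc a) zero    = refl
≡ᵇ-sym (suc a) (suc b) = ≡ᵇ-sym a b

rem4-shift : ∀ k r → 0 < k → k < 4 → r < 4 → (rem4 (k + r) ≡ᵇ r) ≡ false
rem4-shift 1 0 _ _ _ = refl
rem4-shift 1 1 _ _ _ = refl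
rem4-shift 1 2 _ _ _ = refl
rem4-shift 1 3 _ _ _ = refl
rem4-shift 2 0 _ _ _ = refl
rem4-shift 2 1 _ _ _ = refl
rem4-shift 2 2 _ _ _ = refl
rem4-shift 2 3 _ _ _ = refl
rem4-shift 3 0 _ _ _ = refl
rem4-shift 3 1 _ _ _ = refl
rem4-shift 3 2 _ _ _ = refl
rem4-shift 3 3 _ _ _ = refl
rem4-shift (suc (suc (suc (suc k)))) r _ (s≤s (s≤s (s≤s (s≤s ())))) _
rem4-shift k (suc (suc (suc (suc r)))) _ _ (s≤s (s≤s (s≤s (s≤s ()))))

onClass : ℕ → (ℕ → ℕ) → ℕ → ℕ
onClass r g i = if rem4 i ≡ᵇ r then g (quot4 i) else 0

onClass-base4 : ∀ q r g → r < 4 → onClass r g (base4 q r) ≡ g q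
onClass-base4 q r g r<4 = cong₂ (λ b y → if b then g y else 0) in-class (quot4-base4 q r r<4)
  where
  in-class : (rem4 (base4 q r) ≡ᵇ r) ≡ true
  in-class = trans (cong (_≡ᵇ r) (trans (rem4-base4 0 q r) (rem4-small r r<4))) (≡ᵇ-refl r)

onClass-off : ∀ k q r g → 0 < k → k < 4 → r < 4 → onClass r g (k + base4 q r) ≡ 0
onClass-off k q r g 0<k k<4 r<4 =
  cong (λ b → if b then g (quot4 (k + base4 q r)) else 0) (trans (cong (_≡ᵇ r) (rem4-base4 k q r)) (rem4-shift k r 0<k k<4 r<4))

sumBelow-onClass-base4 : ∀ q r g → r < 4 → sumBelow (base4 q r) (onClass r g) ≡ sumBelow q g
sumBelow-onClass-base4 zero 0 g _ = refl
sumBelow-onClass-base4 zero 1 g _ = refl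
sumBelow-onClass-base4 zero 2 g _ = refl
sumBelow-onClass-base4 zero 3 g _ = refl
sumBelow-onClass-base4 zero (suc (suc (suc (suc r)))) g (s≤s (s≤s (s≤s (s≤s ()))))
sumBelow-onClass-base4 (suc q) r g r<4 = begin
    sumBelow (base4 q r) (onClass r g) + onClass r g (base4 q r)
      + onClass r g (1 + base4 q r) + onClass r g (2 + base4 q r) + onClass r g (3 + base4 q r)
  ≡⟨ cong₂ _+_ (cong₂ _+_ (cong₂ _+_ (cong₂ _+_ (sumBelow-onClass-base4 q r g r<4) (onClass-base4 q r g r<4))
       (off 0 (s≤s (s≤s z≤n)))) (off 1 (s≤s (s≤s (s≤s z≤n))))) (off 2 ≤-refl) ⟩
    sumBelow q g + g q + 0 + 0 + 0
  ≡⟨ trans (+-identityʳ _) (trans (+-identityʳ _) (+-identityʳ _)) ⟩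
    sumBelow q g + g q ∎
  where
  open ≡-Reasoning
  off : ∀ k → suc k < 4 → onClass r g (suc k + base4 q r) ≡ 0
  off k k<4 = onClass-off (suc k) q r g (s≤s z≤n) k<4 r<4

-- the indices below n congruent to n mod 4 are exactly the 4i + rem4 n with i < quot4 n
sumBelow-onClass : ∀ n g → sumBelow n (onClass (rem4 n) g) ≡ sumBelow (quot4 n) g
sumBelow-onClass n g =
  subst (λ m → sumBelow m (onClass (rem4 n) g) ≡ sumBelow (quot4 n) g) (base4-quot4-rem4 n)
        (sumBelow-onClass-base4 (quot4 n) (rem4 n) g (rem4<4 n))

sumBelow-rem4 : ∀ q (G : ℕ → ℕ) → sumBelow (base4 q 0) (G ∘ rem4) ≡ q * sumBelow 4 G
sumBelow-rem4 zero    G = refl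
sumBelow-rem4 (suc q) G =
  trans (cong₂ _+_ (cong₂ _+_ (cong₂ _+_ (cong₂ _+_ (sumBelow-rem4 q G) (cong G (rem4-base4 0 q 0)))
                                       (cong G (rem4-base4 1 q 0))) (cong G (rem4-base4 2 q 0))) (cong G (rem4-base4 3 q 0)))
        (one-more-period q (G 0) (G 1) (G 2) (G 3))
  where
  one-more-period : ∀ q a b c d → q * (a + b + c + d) + a + b + c + d ≡ suc q * (a + b + c + d)
  one-more-period = solve-∀

sumBelow-rem4-≥ : ∀ n (G : ℕ → ℕ) → quot4 n * sumBelow 4 G ≤ sumBelow n (G ∘ rem4)
sumBelow-rem4-≥ n G = begin
    quot4 n * sumBelow 4 G
  ≡⟨ sumBelow-rem4 (quot4 n) G ⟨
    sumBelow (base4 (quot4 n) 0) (G ∘ rem4)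
  ≤⟨ sumBelow-monoˡ (G ∘ rem4) full-periods≤n ⟩
    sumBelow n (G ∘ rem4) ∎
  where
  open ≤-Reasoning
  full-periods≤n : base4 (quot4 n) 0 ≤ n
  full-periods≤n = subst₂ _≤_ (sym (base4≡ (quot4 n) 0)) (trans (sym (base4≡ (quot4 n) (rem4 n))) (base4-quot4-rem4 n))
                          (+-monoʳ-≤ (quot4 n * 4) z≤n)

-- The iterated blow-up of a rainbow K₄

every<4 : (ℕ → Bool) → Bool
every<4 p = p 0 ∧ p 1 ∧ p 2 ∧ p 3

T-∧ˡ : ∀ a {b} → T (a ∧ b) → T a
T-∧ˡ true _ = _

T-∧ʳ : ∀ a {b} → T (a ∧ b) → T b
T-∧ʳ true t = t

every<4-sound : ∀ p → T (every<4 p) → ∀ x → x < 4 → T (p x)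
every<4-sound p t 0 _ = T-∧ˡ (p 0) t
every<4-sound p t 1 _ = T-∧ˡ (p 1) (T-∧ʳ (p 0) t)
every<4-sound p t 2 _ = T-∧ˡ (p 2) (T-∧ʳ (p 1) (T-∧ʳ (p 0) t))
every<4-sound p t 3 _ = T-∧ʳ (p 2) (T-∧ʳ (p 1) (T-∧ʳ (p 0) t))
every<4-sound p t (suc (suc (suc (suc x)))) (s≤s (s≤s (s≤s (s≤s ()))))

-- K₄ on {0,1,2,3} coloured by its three perfect matchings {01,23}, {02,13}, {03,12},
-- which are told apart by a + b ∈ {1,5}, {2,4}, {3}.
matchingOf : ℕ → Fin 3
matchingOf 2 = fs fz
matchingOf 3 = fs (fs fz)
matchingOf 4 = fs fz
matchingOf _ = fz

gadget : ℕ → ℕ → Fin 3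
gadget a b = matchingOf (a + b)

distinctᵇ : ℕ → ℕ → ℕ → Bool
distinctᵇ x y z = not (x ≡ᵇ y) ∧ not (x ≡ᵇ z) ∧ not (y ≡ᵇ z)

gadget-rainbow : ∀ x y z → x < 4 → y < 4 → z < 4 → T (distinctᵇ x y z) → distinct3 (gadget x y) (gadget x z) (gadget y z) ≡ true
gadget-rainbow x y z x<4 y<4 z<4 =
  modus-ponens (every<4-sound (claim x y) (every<4-sound (every<4 ∘ claim x) (every<4-sound (λ x → every<4 (every<4 ∘ claim x)) table x x<4) y y<4) z z<4)
  where
  claim : ℕ → ℕ → ℕ → Bool
  claim x y z = not (distinctᵇ x y z) ∨ distinct3 (gadget x y) (gadget x z) (gadget y z)
  -- decided by evaluating all 4³ cases
  table : T (every<4 λ x → every<4 λ y → every<4 λ z → claim x y z)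
  table = _
  modus-ponens : ∀ {a b} → T (not a ∨ b) → T a → b ≡ true
  modus-ponens {true} {true} _ _ = refl

blowup : ℕ → ℕ → ℕ → Fin 3
blowup zero    x y = fz
blowup (suc D) x y = if rem4 x ≡ᵇ rem4 y then blowup D (quot4 x) (quot4 y) else gadget (rem4 x) (rem4 y)

blowup-sym : ∀ D x y → blowup D x y ≡ blowup D y x
blowup-sym zero    x y = refl
blowup-sym (suc D) x y rewrite ≡ᵇ-sym (rem4 x) (rem4 y) with rem4 y ≡ᵇ rem4 x
... | true  = blowup-sym D (quot4 x) (quot4 y)
... | false = cong matchingOf (+-comm (rem4 x) (rem4 y))

blowupRainbow : ℕ → ℕ → ℕ → ℕ → Bool
blowupRainbow D a b d = distinct3 (blowup D a b) (blowup D a d) (blowup D b d)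

rainbowBelow : ℕ → ℕ → ℕ
rainbowBelow D m = sumBelow m λ a → sumBelow m λ b → sumBelow m λ d → ind ((a <ᵇ b) ∧ (b <ᵇ d) ∧ blowupRainbow D a b d)

rainbowUnder : ℕ → ℕ → ℕ
rainbowUnder D m = sumBelow m λ a → sumBelow m λ b → ind ((a <ᵇ b) ∧ (b <ᵇ m) ∧ blowupRainbow D a b m)

crossUnder : ℕ → ℕ
crossUnder n = sumBelow n λ a → sumBelow n λ b → ind ((a <ᵇ b) ∧ distinctᵇ (rem4 a) (rem4 b) (rem4 n))

rainbowBelow-suc : ∀ D m → rainbowBelow D m + rainbowUnder D m ≤ rainbowBelow D (suc m)
rainbowBelow-suc D m = begin
    rainbowBelow D m + rainbowUnder D m
  ≡⟨ sumBelow-distrib-+ m (λ a → sumBelow m λ b → sumBelow m (f a b)) (λ a → sumBelow m λ b → f a b m) ⟨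
    sumBelow m (λ a → sumBelow m (λ b → sumBelow m (f a b)) + sumBelow m (λ b → f a b m))
  ≡⟨ sumBelow-cong m (λ a _ → sumBelow-distrib-+ m (λ b → sumBelow m (f a b)) (λ b → f a b m)) ⟨
    sumBelow m (λ a → sumBelow m (λ b → sumBelow (suc m) (f a b)))
  ≤⟨ sumBelow-mono m (λ a _ → m≤m+n _ _) ⟩
    sumBelow m (λ a → sumBelow (suc m) (λ b → sumBelow (suc m) (f a b)))
  ≤⟨ m≤m+n _ _ ⟩
    rainbowBelow D (suc m) ∎
  where
  open ≤-Reasoning
  f : ℕ → ℕ → ℕ → ℕ
  f a b d = ind ((a <ᵇ b) ∧ (b <ᵇ d) ∧ blowupRainbow D a b d)

ind-same-class : ∀ a b (y x : Bool) → ind ((a <ᵇ b) ∧ false) + ind ((quot4 a <ᵇ quot4 b) ∧ y ∧ x) ≤ ind ((a <ᵇ b) ∧ true ∧ x)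
ind-same-class a b y x rewrite ∧-zeroʳ (a <ᵇ b) with a <ᵇ b in a<ᵇb
... | true  = ≤-trans (ind-∧≤ (quot4 a <ᵇ quot4 b) _) (ind-∧≤ y _)
... | false rewrite <ᵇ-false {quot4 a} {quot4 b} (quot4-mono (≮⇒≥ (λ a<b → subst T a<ᵇb (<⇒<ᵇ a<b)))) = z≤n

ind-cross-class : ∀ a b x → x ≡ true → ind ((a <ᵇ b) ∧ true) + 0 ≤ ind ((a <ᵇ b) ∧ true ∧ x)
ind-cross-class a b x refl rewrite +-identityʳ (ind ((a <ᵇ b) ∧ true)) = ≤-refl

ind-∧false : ∀ a b c → ind ((a <ᵇ b) ∧ false) + 0 ≤ c
ind-∧false a b c rewrite ∧-zeroʳ (a <ᵇ b) = z≤n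

rainbowUnder-term : ∀ D n a b → b < n →
  ind ((a <ᵇ b) ∧ distinctᵇ (rem4 a) (rem4 b) (rem4 n))
    + onClass (rem4 n) (λ qa → onClass (rem4 n) (λ qb → ind ((qa <ᵇ qb) ∧ (qb <ᵇ quot4 n) ∧ blowupRainbow D qa qb (quot4 n))) b) a
  ≤ ind ((a <ᵇ b) ∧ (b <ᵇ n) ∧ blowupRainbow (suc D) a b n)
rainbowUnder-term D n a b b<n rewrite <ᵇ-true b<n
  with rem4 a ≡ᵇ rem4 b in ab | rem4 a ≡ᵇ rem4 n in an | rem4 b ≡ᵇ rem4 n in bn
... | true  | true  | true  = ind-same-class a b (quot4 b <ᵇ quot4 n) (blowupRainbow D (quot4 a) (quot4 b) (quot4 n))
... | false | true  | true  with () ← trans (sym ab) (≡⇒≡ᵇ-true (rem4 a) (rem4 b)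
                                          (trans (≡ᵇ-true⇒≡ (rem4 a) (rem4 n) an) (sym (≡ᵇ-true⇒≡ (rem4 b) (rem4 n) bn))))
... | true  | true  | false = ind-∧false a b _
... | false | true  | false = ind-∧false a b _
... | true  | false | true  = ind-∧false a b _
... | false | false | true  = ind-∧false a b _
... | true  | false | false = ind-∧false a b _
... | false | false | false = ind-cross-class a b _
  (gadget-rainbow (rem4 a) (rem4 b) (rem4 n) (rem4<4 a) (rem4<4 b) (rem4<4 n) (subst T (sym distinct) _))
  where
  distinct : distinctᵇ (rem4 a) (rem4 b) (rem4 n) ≡ true
  distinct rewrite ab | an | bn = refl

rainbowUnder-split : ∀ D n → crossUnder n + rainbowUnder D (quot4 n) ≤ rainbowUnder (suc D) n
rainbowUnder-split D n = begin
    crossUnder n + rainbowUnder D (quot4 n)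
  ≡⟨ cong (crossUnder n +_) inClass≡ ⟨
    crossUnder n + sumBelow n (λ a → sumBelow n (inClass a))
  ≡⟨ sumBelow-distrib-+ n (λ a → sumBelow n (cross a)) (λ a → sumBelow n (inClass a)) ⟨
    sumBelow n (λ a → sumBelow n (cross a) + sumBelow n (inClass a))
  ≡⟨ sumBelow-cong n (λ a _ → sumBelow-distrib-+ n (cross a) (inClass a)) ⟨
    sumBelow n (λ a → sumBelow n (λ b → cross a b + inClass a b))
  ≤⟨ sumBelow-mono n (λ a _ → sumBelow-mono n (λ b b<n → rainbowUnder-term D n a b b<n)) ⟩
    rainbowUnder (suc D) n ∎
  where
  open ≤-Reasoning
  r = rem4 n
  below : ℕ → ℕ → ℕ
  below qa qb = ind ((qa <ᵇ qb) ∧ (qb <ᵇ quot4 n) ∧ blowupRainbow D qa qb (quot4 n))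
  cross inClass : ℕ → ℕ → ℕ
  cross a b = ind ((a <ᵇ b) ∧ distinctᵇ (rem4 a) (rem4 b) r)
  inClass a b = onClass r (λ qa → onClass r (below qa) b) a
  inClass≡ : sumBelow n (λ a → sumBelow n (inClass a)) ≡ rainbowUnder D (quot4 n)
  inClass≡ = trans (sumBelow-cong n (λ a _ → trans (sumBelow-if n (rem4 a ≡ᵇ r) (onClass r (below (quot4 a))))
                                            (cong (λ x → if rem4 a ≡ᵇ r then x else 0) (sumBelow-onClass n (below (quot4 a))))))
                   (sumBelow-onClass n (λ qa → sumBelow (quot4 n) (below qa)))

distinctᵇ-swap : ∀ x y z → distinctᵇ y x z ≡ distinctᵇ x y z
distinctᵇ-swap x y z = cong₂ _∧_ (cong not (≡ᵇ-sym y x)) (∧-comm (not (y ≡ᵇ z)) (not (x ≡ᵇ z)))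

distinctᵇ-rem4⇒≢ : ∀ a b z → distinctᵇ (rem4 a) (rem4 b) z ≡ true → a ≢ b
distinctᵇ-rem4⇒≢ a b z d refl rewrite ≡ᵇ-refl (rem4 a) with () ← d

distinctPairs : ℕ → ℕ
distinctPairs r = sumBelow 4 λ x → sumBelow 4 λ y → ind (distinctᵇ x y r)

distinctPairs≡6 : ∀ r → r < 4 → distinctPairs r ≡ 6
distinctPairs≡6 0 _ = refl
distinctPairs≡6 1 _ = refl
distinctPairs≡6 2 _ = refl
distinctPairs≡6 3 _ = refl
distinctPairs≡6 (suc (suc (suc (suc r)))) (s≤s (s≤s (s≤s (s≤s ()))))

-- each of the other three residue classes has at least quot4 n elements below n
crossUnder-≥ : ∀ n → 3 * (quot4 n * quot4 n) ≤ crossUnder n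
crossUnder-≥ n = *-cancelˡ-≤ 2 (begin
    2 * (3 * (q * q))
  ≡⟨ *-assoc 2 3 (q * q) ⟨
    6 * (q * q)
  ≡⟨ cong (λ t → t * (q * q)) (distinctPairs≡6 r (rem4<4 n)) ⟨
    distinctPairs r * (q * q)
  ≡⟨ reassociate q (distinctPairs r) ⟩
    q * (q * distinctPairs r)
  ≡⟨ cong (q *_) (sumBelow-*ˡ q 4 (λ x → sumBelow 4 (λ y → ind (distinctᵇ x y r)))) ⟩
    q * sumBelow 4 (λ x → q * sumBelow 4 (λ y → ind (distinctᵇ x y r)))
  ≤⟨ sumBelow-rem4-≥ n (λ x → q * sumBelow 4 (λ y → ind (distinctᵇ x y r))) ⟩
    sumBelow n (λ a → q * sumBelow 4 (λ y → ind (distinctᵇ (rem4 a) y r)))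
  ≤⟨ sumBelow-mono n (λ a _ → sumBelow-rem4-≥ n (λ y → ind (distinctᵇ (rem4 a) y r))) ⟩
    sumBelow n (λ a → sumBelow n (λ b → ind (distinctᵇ (rem4 a) (rem4 b) r)))
  ≡⟨ sumBelow-ordered-pairs n (λ a b → distinctᵇ (rem4 a) (rem4 b) r)
       (λ a b → distinctᵇ-swap (rem4 a) (rem4 b) r) (λ a b → distinctᵇ-rem4⇒≢ a b r) ⟩
    2 * crossUnder n ∎)
  where
  open ≤-Reasoning
  q = quot4 n
  r = rem4 n
  reassociate : ∀ q s → s * (q * q) ≡ q * (q * s)
  reassociate = solve-∀

square-base4-≤ : ∀ q r → r < 4 → (q * 4 + r) * (q * 4 + r) + 9 * q ≤ 16 * (q * q) + 9 * (q * 4 + r)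
square-base4-≤ q 0 _ = subst ((q * 4 + 0) * (q * 4 + 0) + 9 * q ≤_) (e q) (m≤m+n _ (27 * q))
  where
  e : ∀ q → (q * 4 + 0) * (q * 4 + 0) + 9 * q + 27 * q ≡ 16 * (q * q) + 9 * (q * 4 + 0)
  e = solve-∀
square-base4-≤ q 1 _ = subst ((q * 4 + 1) * (q * 4 + 1) + 9 * q ≤_) (e q) (m≤m+n _ (19 * q + 8))
  where
  e : ∀ q → (q * 4 + 1) * (q * 4 + 1) + 9 * q + (19 * q + 8) ≡ 16 * (q * q) + 9 * (q * 4 + 1)
  e = solve-∀
square-base4-≤ q 2 _ = subst ((q * 4 + 2) * (q * 4 + 2) + 9 * q ≤_) (e q) (m≤m+n _ (11 * q + 14))
  where
  e : ∀ q → (q * 4 + 2) * (q * 4 + 2) + 9 * q + (11 * q + 14) ≡ 16 * (q * q) + 9 * (q * 4 + 2)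
  e = solve-∀
square-base4-≤ q 3 _ = subst ((q * 4 + 3) * (q * 4 + 3) + 9 * q ≤_) (e q) (m≤m+n _ (3 * q + 18))
  where
  e : ∀ q → (q * 4 + 3) * (q * 4 + 3) + 9 * q + (3 * q + 18) ≡ 16 * (q * q) + 9 * (q * 4 + 3)
  e = solve-∀
square-base4-≤ q (suc (suc (suc (suc r)))) (s≤s (s≤s (s≤s (s≤s ()))))

-- With q = quot4 n, the cross pairs give 3q² and the class of n recursively q²/5 more, while n² ≈ 16q².
rainbowUnder-≥ : ∀ D n → n ≤ D → n * n ≤ 5 * rainbowUnder D n + 9 * n
rainbowUnder-≥ zero    .zero z≤n = z≤n
rainbowUnder-≥ (suc D) n n≤1+D = +-cancelʳ-≤ (9 * q) (n * n) (5 * rainbowUnder (suc D) n + 9 * n) (begin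
    n * n + 9 * q
  ≡⟨ cong (λ m → m * m + 9 * q) n≡ ⟩
    (q * 4 + rem4 n) * (q * 4 + rem4 n) + 9 * q
  ≤⟨ square-base4-≤ q (rem4 n) (rem4<4 n) ⟩
    16 * (q * q) + 9 * (q * 4 + rem4 n)
  ≡⟨ cong (λ m → 16 * (q * q) + 9 * m) n≡ ⟨
    16 * (q * q) + 9 * n
  ≡⟨ regroup (q * q) (9 * n) ⟩
    5 * (3 * (q * q)) + q * q + 9 * n
  ≤⟨ +-monoˡ-≤ (9 * n) (+-mono-≤ (*-monoʳ-≤ 5 (crossUnder-≥ n)) (rainbowUnder-≥ D q q≤D)) ⟩
    5 * crossUnder n + (5 * rainbowUnder D q + 9 * q) + 9 * n
  ≡⟨ regroup′ (crossUnder n) (rainbowUnder D q) (9 * q) (9 * n) ⟩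
    5 * (crossUnder n + rainbowUnder D q) + 9 * n + 9 * q
  ≤⟨ +-monoˡ-≤ (9 * q) (+-monoˡ-≤ (9 * n) (*-monoʳ-≤ 5 (rainbowUnder-split D n))) ⟩
    5 * rainbowUnder (suc D) n + 9 * n + 9 * q ∎)
  where
  open ≤-Reasoning
  q = quot4 n
  q≤D : q ≤ D
  q≤D = quot4-≤-pred n n≤1+D
  n≡ : n ≡ q * 4 + rem4 n
  n≡ = trans (sym (base4-quot4-rem4 n)) (base4≡ q (rem4 n))
  regroup : ∀ x y → 16 * x + y ≡ 5 * (3 * x) + x + y
  regroup = solve-∀
  regroup′ : ∀ a b c d → 5 * a + (5 * b + c) + d ≡ 5 * (a + b) + d + c
  regroup′ = solve-∀

rainbowBelow-≥ : ∀ D m → m ≤ D → m * m * m ≤ 15 * rainbowBelow D m + 15 * (m * m)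
rainbowBelow-≥ D zero    _   = z≤n
rainbowBelow-≥ D (suc m) m<D = begin
    suc m * suc m * suc m
  ≡⟨ cube m ⟩
    m * m * m + 3 * (m * m) + 3 * m + 1
  ≤⟨ +-monoˡ-≤ 1 (+-monoˡ-≤ (3 * m) (+-mono-≤ (rainbowBelow-≥ D m m≤D) 3m²≤)) ⟩
    15 * rainbowBelow D m + 15 * (m * m) + (15 * rainbowUnder D m + 27 * m) + 3 * m + 1
  ≡⟨ regroup (rainbowBelow D m) (rainbowUnder D m) m ⟩
    15 * (rainbowBelow D m + rainbowUnder D m) + (15 * (m * m) + 30 * m + 1)
  ≤⟨ +-mono-≤ (*-monoʳ-≤ 15 (rainbowBelow-suc D m)) (subst (15 * (m * m) + 30 * m + 1 ≤_) (square m) (m≤m+n _ 14)) ⟩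
    15 * rainbowBelow D (suc m) + 15 * (suc m * suc m) ∎
  where
  open ≤-Reasoning
  m≤D : m ≤ D
  m≤D = ≤-trans (n≤1+n m) m<D
  3m²≤ : 3 * (m * m) ≤ 15 * rainbowUnder D m + 27 * m
  3m²≤ = subst (3 * (m * m) ≤_) (times3 (rainbowUnder D m) m) (*-monoʳ-≤ 3 (rainbowUnder-≥ D m m≤D))
    where
    times3 : ∀ a m → 3 * (5 * a + 9 * m) ≡ 15 * a + 27 * m
    times3 = solve-∀
  cube : ∀ m → suc m * suc m * suc m ≡ m * m * m + 3 * (m * m) + 3 * m + 1
  cube = solve-∀
  regroup : ∀ t a m → 15 * t + 15 * (m * m) + (15 * a + 27 * m) + 3 * m + 1 ≡ 15 * (t + a) + (15 * (m * m) + 30 * m + 1)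
  regroup = solve-∀
  square : ∀ m → 15 * (m * m) + 30 * m + 1 + 14 ≡ 15 * (suc m * suc m)
  square = solve-∀

blowupColoring : (n : ℕ) → Coloring n
blowupColoring n = record
  { col = λ i j → blowup n (toℕ i) (toℕ j)
  ; sym = λ i j → blowup-sym n (toℕ i) (toℕ j)
  }

rainbowCount-blowup : ∀ n → rainbowCount (blowupColoring n) ≡ rainbowBelow n n
rainbowCount-blowup n = trans (rainbowCount≡∑³ (blowupColoring n))
  (trans (sum-cong-≗ {n} λ i → trans (sum-cong-≗ {n} λ j → ∑-toℕ n (f (toℕ i) (toℕ j)))
                                 (∑-toℕ n (λ b → sumBelow n (f (toℕ i) b))))
         (∑-toℕ n (λ a → sumBelow n λ b → sumBelow n (f a b))))
  where
  f : ℕ → ℕ → ℕ → ℕ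
  f a b d = ind ((a <ᵇ b) ∧ (b <ᵇ d) ∧ blowupRainbow n a b d)

rainbowAt-extremal-≥ : ∀ {n} (c : Coloring n) → Extremal c → (v : Fin n) → n * n ≤ 5 * rainbowAt c v + 25 * n
rainbowAt-extremal-≥ {n@(suc _)} c extremal v = *-cancelˡ-≤ n (begin
    n * (n * n)
  ≡⟨ *-assoc n n n ⟨
    n * n * n
  ≤⟨ rainbowBelow-≥ n n ≤-refl ⟩
    15 * rainbowBelow n n + 15 * (n * n)
  ≡⟨ cong (λ t → 15 * t + 15 * (n * n)) (rainbowCount-blowup n) ⟨
    15 * rainbowCount (blowupColoring n) + 15 * (n * n)
  ≤⟨ +-monoˡ-≤ (15 * (n * n)) (*-monoʳ-≤ 15 (extremal (blowupColoring n))) ⟩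
    15 * rainbowCount c + 15 * (n * n)
  ≡⟨ cong (_+ 15 * (n * n)) (*-assoc 5 3 (rainbowCount c)) ⟩
    5 * (3 * rainbowCount c) + 15 * (n * n)
  ≤⟨ +-monoˡ-≤ (15 * (n * n)) (*-monoʳ-≤ 5 (rainbowCount-extremal c extremal v)) ⟩
    5 * (n * (rainbowAt c v + (n + n))) + 15 * (n * n)
  ≡⟨ expand n (rainbowAt c v) ⟩
    n * (5 * rainbowAt c v + 25 * n) ∎)
  where
  open ≤-Reasoning
  expand : ∀ n R → 5 * (n * (R + (n + n))) + 15 * (n * n) ≡ n * (5 * R + 25 * n)
  expand = solve-∀

-- The density bound

2*choose2+m : ∀ m → 2 * (m C 2) + m ≡ m * m
2*choose2+m zero    = refl
2*choose2+m (suc m) = begin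
    2 * (suc m C 2) + suc m
  ≡⟨ cong (λ x → 2 * x + suc m) (nCk+nC[k+1]≡[n+1]C[k+1] m 1) ⟨
    2 * (m C 1 + m C 2) + suc m
  ≡⟨ cong (λ x → 2 * (x + m C 2) + suc m) (nC1≡n m) ⟩
    2 * (m + m C 2) + suc m
  ≡⟨ regroup m (m C 2) ⟩
    (2 * (m C 2) + m) + 2 * m + 1
  ≡⟨ cong (λ x → x + 2 * m + 1) (2*choose2+m m) ⟩
    m * m + 2 * m + 1
  ≡⟨ square m ⟩
    suc m * suc m ∎
  where
  open ≡-Reasoning
  regroup : ∀ m c → 2 * (m + c) + suc m ≡ (2 * c + m) + 2 * m + 1
  regroup = solve-∀
  square : ∀ m → m * m + 2 * m + 1 ≡ suc m * suc m
  square = solve-∀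

2*choose2-≤ : ∀ m R → suc m * suc m ≤ 5 * R + 25 * suc m → 2 * (m C 2) ≤ 5 * R + (22 * m + 24)
2*choose2-≤ m R n²≤ = +-cancelʳ-≤ (3 * m + 1) (2 * (m C 2)) (5 * R + (22 * m + 24))
  (subst₂ _≤_ (trans (square m) (trans (cong (λ x → x + 2 * m + 1) (sym (2*choose2+m m))) (regroup (m C 2) m)))
              (split R m) n²≤)
  where
  square : ∀ m → suc m * suc m ≡ m * m + 2 * m + 1
  square = solve-∀
  regroup : ∀ c m → 2 * c + m + 2 * m + 1 ≡ 2 * c + (3 * m + 1)
  regroup = solve-∀
  split : ∀ R m → 5 * R + 25 * suc m ≡ 5 * R + (22 * m + 24) + (3 * m + 1)
  split = solve-∀

slack-≤ : ∀ m D → 10 + 20 * D ≤ m → D * (22 * m + 24) ≤ 5 * (m C 2)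
slack-≤ m D m≥ = *-cancelˡ-≤ 2 (+-cancelʳ-≤ (5 * m) _ _ (begin
    2 * (D * (22 * m + 24)) + 5 * m
  ≤⟨ subst (λ x → 2 * (D * (22 * x + 24)) + 5 * x ≤ 5 * (x * x)) (m∸n+n≡m m≥) (poly D (m ∸ (10 + 20 * D))) ⟩
    5 * (m * m)
  ≡⟨ cong (5 *_) (2*choose2+m m) ⟨
    5 * (2 * (m C 2) + m)
  ≡⟨ distrib (m C 2) m ⟩
    2 * (5 * (m C 2)) + 5 * m ∎))
  where
  open ≤-Reasoning
  -- with m = k + (10 + 20D) the difference of the two sides has nonnegative coefficients
  identity : ∀ D k → 2 * (D * (22 * (k + (10 + 20 * D)) + 24)) + 5 * (k + (10 + 20 * D))
                     + (1120 * (D * D) + 1412 * D + 156 * (D * k) + 450 + 95 * k + 5 * (k * k))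
                   ≡ 5 * ((k + (10 + 20 * D)) * (k + (10 + 20 * D)))
  identity = solve-∀
  poly : ∀ D k → 2 * (D * (22 * (k + (10 + 20 * D)) + 24)) + 5 * (k + (10 + 20 * D))
                 ≤ 5 * ((k + (10 + 20 * D)) * (k + (10 + 20 * D)))
  poly D k = subst (2 * (D * (22 * (k + (10 + 20 * D)) + 24)) + 5 * (k + (10 + 20 * D)) ≤_) (identity D k) (m≤m+n _ _)
  distrib : ∀ c m → 5 * (2 * c + m) ≡ 2 * (5 * c) + 5 * m
  distrib = solve-∀

density-ℕ : ∀ m D P R → 1 ≤ P → 10 + 20 * D ≤ m → suc m * suc m ≤ 5 * R + 25 * suc m →
  2 * D * (m C 2) ≤ 5 * D * R + 5 * P * (m C 2)
density-ℕ m D P R 1≤P m≥ n²≤ = begin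
    2 * D * (m C 2)
  ≡⟨ swap D (m C 2) ⟩
    D * (2 * (m C 2))
  ≤⟨ *-monoʳ-≤ D (2*choose2-≤ m R n²≤) ⟩
    D * (5 * R + (22 * m + 24))
  ≡⟨ distrib D R m ⟩
    5 * D * R + D * (22 * m + 24)
  ≤⟨ +-monoʳ-≤ (5 * D * R) (slack-≤ m D m≥) ⟩
    5 * D * R + 5 * (m C 2)
  ≤⟨ +-monoʳ-≤ (5 * D * R) (*-monoˡ-≤ (m C 2) (*-monoʳ-≤ 5 1≤P)) ⟩
    5 * D * R + 5 * P * (m C 2) ∎
  where
  open ≤-Reasoning
  swap : ∀ D c → 2 * D * c ≡ D * (2 * c)
  swap = solve-∀
  distrib : ∀ D R m → D * (5 * R + (22 * m + 24)) ≡ 5 * D * R + D * (22 * m + 24)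
  distrib = solve-∀

ℕ→ℚ-toℚᵘ : ∀ k → ℚ.toℚᵘ (ℕ→ℚ k) ℚᵘ.≃ ℚᵘ.mkℚᵘ (ℤ.+ k) 0
ℕ→ℚ-toℚᵘ k = ℚ.toℚᵘ-cong (ℚ.↥p/↧p≡p (ℚ.mkℚ (ℤ.+ k) 0 (Coprime-sym (1-coprimeTo k))))

-- density-ℚ with its denominators 5 and suc dd cleared, in the normal form of ℚᵘ._≤_
density-ℤ : ∀ p dd K R → 2 * suc dd * K ≤ 5 * suc dd * R + 5 * suc p * K →
  ((ℤ.+ 2 ℤ.* ℤ.+ suc dd ℤ.+ -[1+ p ] ℤ.* ℤ.+ 5) ℤ.* ℤ.+ K) ℤ.* ℤ.+ 1 ℤ.≤ ℤ.+ R ℤ.* ℤ.+ (5 * suc dd * 1)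
density-ℤ p dd K R h = subst₂ ℤ._≤_ (sym (lhs (ℤ.+ suc dd) (ℤ.+ suc p) (ℤ.+ K))) (sym (rhs (ℤ.+ suc dd) (ℤ.+ R)))
  (move (ℤ.+ 2 ℤ.* ℤ.+ suc dd ℤ.* ℤ.+ K) (ℤ.+ 5 ℤ.* ℤ.+ suc dd ℤ.* ℤ.+ R) (ℤ.+ 5 ℤ.* ℤ.+ suc p ℤ.* ℤ.+ K) h′)
  where
  pos-*³ : ∀ a b c → ℤ.+ (a * b * c) ≡ ℤ.+ a ℤ.* ℤ.+ b ℤ.* ℤ.+ c
  pos-*³ a b c = trans (ℤ.pos-* (a * b) c) (cong (ℤ._* ℤ.+ c) (ℤ.pos-* a b))
  h′ : ℤ.+ 2 ℤ.* ℤ.+ suc dd ℤ.* ℤ.+ K ℤ.≤ ℤ.+ 5 ℤ.* ℤ.+ suc dd ℤ.* ℤ.+ R ℤ.+ ℤ.+ 5 ℤ.* ℤ.+ suc p ℤ.* ℤ.+ K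
  h′ = subst₂ ℤ._≤_ (pos-*³ 2 (suc dd) K)
         (trans (ℤ.pos-+ (5 * suc dd * R) (5 * suc p * K)) (cong₂ ℤ._+_ (pos-*³ 5 (suc dd) R) (pos-*³ 5 (suc p) K)))
         (ℤ.+≤+ h)
  move : ∀ x y z → x ℤ.≤ y ℤ.+ z → x ℤ.+ ℤ.- z ℤ.≤ y
  move x y z x≤ = subst (x ℤ.+ ℤ.- z ℤ.≤_) (cancel y z) (ℤ.+-monoˡ-≤ (ℤ.- z) x≤)
    where
    cancel : ∀ y z → y ℤ.+ z ℤ.+ ℤ.- z ≡ y
    cancel = ℤsolve-∀
  lhs : ∀ d P c → ((ℤ.+ 2 ℤ.* d ℤ.+ (ℤ.- P) ℤ.* ℤ.+ 5) ℤ.* c) ℤ.* ℤ.+ 1 ≡ ℤ.+ 2 ℤ.* d ℤ.* c ℤ.+ ℤ.- (ℤ.+ 5 ℤ.* P ℤ.* c)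
  lhs = ℤsolve-∀
  rhs : ∀ d r → r ℤ.* (ℤ.+ 5 ℤ.* d ℤ.* ℤ.+ 1) ≡ ℤ.+ 5 ℤ.* d ℤ.* r
  rhs = ℤsolve-∀

density-ℚ : ∀ p dd .(cop : Coprime (suc p) (suc dd)) K R → 2 * suc dd * K ≤ 5 * suc dd * R + 5 * suc p * K →
  ((ℤ.+ 2 ℚ./ 5) ℚ.- ℚ.mkℚ +[1+ p ] dd cop) ℚ.* ℕ→ℚ K ℚ.≤ ℕ→ℚ R
density-ℚ p dd cop K R h =
  ℚ.toℚᵘ-cancel-≤ (ℚᵘ.≤-respˡ-≃ (ℚᵘ.≃-sym lhs) (ℚᵘ.≤-respʳ-≃ (ℚᵘ.≃-sym (ℕ→ℚ-toℚᵘ R)) (ℚᵘ.*≤* (density-ℤ p dd K R h))))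
  where
  ε = ℚ.mkℚ +[1+ p ] dd cop
  lhs : ℚ.toℚᵘ (((ℤ.+ 2 ℚ./ 5) ℚ.- ε) ℚ.* ℕ→ℚ K) ℚᵘ.≃ ((ℚᵘ.mkℚᵘ (ℤ.+ 2) 4 ℚᵘ.+ ℚᵘ.- ℚᵘ.mkℚᵘ +[1+ p ] dd) ℚᵘ.* ℚᵘ.mkℚᵘ (ℤ.+ K) 0)
  lhs = ℚᵘ.≃-trans (ℚ.toℚᵘ-homo-* ((ℤ.+ 2 ℚ./ 5) ℚ.- ε) (ℕ→ℚ K))
          (ℚᵘ.*-cong (ℚᵘ.≃-trans (ℚ.toℚᵘ-homo-+ (ℤ.+ 2 ℚ./ 5) (ℚ.- ε)) (ℚᵘ.+-cong (ℚᵘ.≃-refl {ℚ.toℚᵘ (ℤ.+ 2 ℚ./ 5)}) (ℚ.toℚᵘ-homo‿- ε)))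
                     (ℕ→ℚ-toℚᵘ K))

corollary4p3 : (ε : ℚ.ℚ) → ℚ.0ℚ ℚ.< ε →
  ∃[ n₀ ] ((n : ℕ) → n ≥ n₀ → (c : Coloring n) → Extremal c → (v : Fin n) →
    ((ℤ.+ 2 ℚ./ 5) ℚ.- ε) ℚ.* ℕ→ℚ ((n ∸ 1) C 2) ℚ.≤ ℕ→ℚ (rainbowAt c v))
corollary4p3 (ℚ.mkℚ +[1+ p ] dd cop) _ = 11 + 20 * suc dd , bound
  where
  -- ε ≥ 1 / suc dd, and this n₀ makes the O(n) error of n² ≤ 5R + 25n smaller than that
  bound : ∀ n → n ≥ 11 + 20 * suc dd → (c : Coloring n) → Extremal c → (v : Fin n) →
    ((ℤ.+ 2 ℚ./ 5) ℚ.- ℚ.mkℚ +[1+ p ] dd cop) ℚ.* ℕ→ℚ ((n ∸ 1) C 2) ℚ.≤ ℕ→ℚ (rainbowAt c v)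
  bound (suc m) (s≤s m≥) c extremal v =
    density-ℚ p dd cop (m C 2) (rainbowAt c v)
      (density-ℕ m (suc dd) (suc p) (rainbowAt c v) (s≤s z≤n) m≥ (rainbowAt-extremal-≥ c extremal v))
corollary4p3 (ℚ.mkℚ (ℤ.+ 0)   _ _) (ℚ.*<* (ℤ.+<+ ()))
corollary4p3 (ℚ.mkℚ -[1+ _ ] _ _) (ℚ.*<* ())
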